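{- Let $G$ be a connected undirected graph, $k\ge1$ a natural number and $0<\varepsilon\le1$. If $G$ contains a $(k,\varepsilon)$-linked subpartition, then it contains a $(k,\varepsilon)$-linked partition.
   Context: Let $G=(V,E)$ be a connected undirected graph with $n=|V|$. A $(k,\varepsilon)$-linked partition consists of a set $L\subseteq V$ of size exactly $k$ and a partition of $S=V\setminus L$ into sets $\{S_i:i\in L\}$, each of size at least $(\varepsilon n/k)-1$, such that for each $i\in L$ and each $j\in S_i$ there is an $i$–$j$ path in $G$ using only nodes of $S\cup\{i\}$. A $(k,\varepsilon)$-linked subpartition consists of a set $L\subseteq V$ of size $\ell\ge k$, together with pairwise disjoint subsets $S_i\subseteq S=V\setminus L$ for $i\in L$ (not necessarily covering $S$), each of size at least $(\varepsilon n/k)-1$, such that for each $i\in L$ and each $j\in S_i$ there is an $i$–$j$ path in $G$ using only nodes of $S\cup\{i\}$.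
   Formalization: The parameter ε ranges over the rationals in (0,1] rather than over the real numbers. -}

module Defs where

open import Data.Nat using (ℕ; suc; _*_; _≤_; _≥_)
open import Data.Fin using (Fin)
open import Data.Fin.Subset using (Subset; _∈_; _∉_; _⊆_; ∣_∣)
open import Data.Product using (Σ; _×_; ∃-syntax)
open import Relation.Binary.PropositionalEquality using (_≡_)
open import Relation.Nullary using (¬_)
open import Data.Sum using (_⊎_)
open import Data.Unit using (⊤)

record Graph (n : ℕ) : Set₁ where
  field
    Adj : Fin n → Fin n → Set
    sym : ∀ {u v} → Adj u v → Adj v u
open Graph public

-- Walks from u to v all of whose vertices satisfy P.
-- (An i–j path inside a vertex set exists iff such a walk exists.)
data WalkIn {n : ℕ} (G : Graph n) (P : Fin n → Set) : Fin n → Fin n → Set where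
  here : ∀ {u} → P u → WalkIn G P u u
  step : ∀ {u w v} → P u → Adj G u w → WalkIn G P w v → WalkIn G P u v

everywhere : {n : ℕ} → Fin n → Set
everywhere _ = ⊤

Connected : {n : ℕ} → Graph n → Set
Connected G = ∀ u v → WalkIn G everywhere u v

-- Vertices allowed on paths from i: those in S = V ∖ L, together with i.
InSOr : {n : ℕ} → Subset n → Fin n → Fin n → Set
InSOr L i v = v ∉ L ⊎ v ≡ i

-- ε = p / q (a rational).  |S_i| ≥ ε n / k − 1  ⟺  p * n ≤ q * k * (|S_i| + 1).
LargeEnough : (n k p q : ℕ) → ℕ → Set
LargeEnough n k p q s = p * n ≤ q * k * suc s

LinkedFamily : {n : ℕ} → Graph n → (k p q : ℕ) → Subset n → (Fin n → Subset n) → Set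
LinkedFamily {n} G k p q L S =
  (∀ i → i ∈ L → ∀ j → j ∈ S i → j ∉ L)
  × (∀ i → i ∈ L → LargeEnough n k p q ∣ S i ∣)
  × (∀ i → i ∈ L → ∀ j → j ∈ S i → WalkIn G (InSOr L i) i j)
  × (∀ i i' → i ∈ L → i' ∈ L → ¬ (i ≡ i') → ∀ j → j ∈ S i → ¬ (j ∈ S i'))

LinkedPartition : {n : ℕ} → Graph n → (k p q : ℕ) → Set
LinkedPartition {n} G k p q =
  Σ (Subset n) λ L → Σ (Fin n → Subset n) λ S →
    (∣ L ∣ ≡ k) × LinkedFamily G k p q L S
    × (∀ j → j ∉ L → ∃[ i ] (i ∈ L × j ∈ S i))

LinkedSubpartition : {n : ℕ} → Graph n → (k p q : ℕ) → Set
LinkedSubpartition {n} G k p q =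
  Σ (Subset n) λ L → Σ (Fin n → Subset n) λ S →
    (∣ L ∣ ≥ k) × LinkedFamily G k p q L S

module Submission where

-- Given a linked subpartition (L, S) with |L| ≥ k, we first
-- shrink L to a subset L' ⊆ L of exactly k leaders.  Dropping leaders keeps
-- the family linked: a walk avoiding L also avoids L', and the discarded
-- leaders simply become ordinary vertices of V ∖ L'.  Then we enlarge the
-- sets S_i until they cover V ∖ L'.  Fix a leader l₀; by connectivity every
-- vertex u has a walk to l₀.  Following that walk from u, we stop at the
-- first vertex that is a leader or already belongs to some S_i; that gives a
-- leader i together with a walk from i to u through S ∪ {i}, and we assign u
-- to i.  Vertices of S_i are assigned to i itself (they stop immediately), so
-- the new sets contain the old ones, keep the size bound, are pairwise
-- disjoint (each vertex has a single assigned leader) and cover V ∖ L'.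

open import Defs
open import Data.Nat using (ℕ; zero; suc; _*_; _≤_; _<_; s≤s)
open import Data.Nat.Properties using (≤-trans; *-monoʳ-≤)
open import Data.Fin using (Fin) renaming (_≟_ to _≟ᶠ_)
open import Data.Fin.Subset
  using (Subset; _∈_; _∉_; _⊆_; ∣_∣; inside; outside; ⊥; Nonempty)
open import Data.Fin.Subset.Properties
  using (_∈?_; ∉⊥; ∣⊥∣≡0; p⊆q⇒∣p∣≤∣q∣; nonempty?; Empty-unique)
open import Data.Fin.Properties using (any?)
open import Data.Vec using (_∷_; here; there; tabulate)
open import Data.Vec.Properties using (lookup∘tabulate; []=⇒lookup; lookup⇒[]=)
open import Data.Product using (Σ; ∃; ∃-syntax; _×_; _,_; proj₁; proj₂)
open import Data.Sum using (inj₁; inj₂; [_,_]′)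
open import Data.Empty using (⊥-elim)
open import Relation.Binary.PropositionalEquality
  using (_≡_; refl; trans; cong; subst)
  renaming (sym to ≡-sym)
open import Relation.Nullary using (Dec; yes; no; does)
open import Relation.Nullary.Decidable using (dec-true; ¬?; _×-dec_)
open import Relation.Unary using (Decidable)

exactSubset : ∀ {n} k (A : Subset n) → k ≤ ∣ A ∣ → Σ (Subset n) λ B → B ⊆ A × ∣ B ∣ ≡ k
exactSubset {n} zero A _ = ⊥ , (λ x∈⊥ → ⊥-elim (∉⊥ x∈⊥)) , ∣⊥∣≡0 n
exactSubset (suc k) (inside ∷ A) (s≤s k≤∣A∣) with exactSubset k A k≤∣A∣
... | B , B⊆A , ∣B∣≡k = inside ∷ B , ⊆-cons , cong suc ∣B∣≡k
  where
  ⊆-cons : inside ∷ B ⊆ inside ∷ A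
  ⊆-cons here = here
  ⊆-cons (there x∈B) = there (B⊆A x∈B)
exactSubset (suc k) (outside ∷ A) k≤∣A∣ with exactSubset (suc k) A k≤∣A∣
... | B , B⊆A , ∣B∣≡k = outside ∷ B , ⊆-cons , ∣B∣≡k
  where
  ⊆-cons : outside ∷ B ⊆ outside ∷ A
  ⊆-cons (there x∈B) = there (B⊆A x∈B)

nonempty-of-size : ∀ {n k} (A : Subset n) → ∣ A ∣ ≡ suc k → Nonempty A
nonempty-of-size {n} A ∣A∣≡1+k with nonempty? A
... | yes ne = ne
... | no empty with trans (≡-sym ∣A∣≡1+k) (trans (cong ∣_∣ (Empty-unique empty)) (∣⊥∣≡0 n))
...   | ()

comprehension : ∀ {n} {P : Fin n → Set} → Decidable P → Subset n
comprehension P? = tabulate (λ j → does (P? j))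

∈-comprehension⁺ : ∀ {n} {P : Fin n → Set} (P? : Decidable P) {j} → P j → j ∈ comprehension P?
∈-comprehension⁺ P? {j} pj =
  lookup⇒[]= j (comprehension P?) (trans (lookup∘tabulate _ j) (dec-true (P? j) pj))

∈-comprehension⁻ : ∀ {n} {P : Fin n → Set} (P? : Decidable P) {j} → j ∈ comprehension P? → P j
∈-comprehension⁻ P? {j} j∈ with P? j | trans (≡-sym (lookup∘tabulate (λ j → does (P? j)) j)) ([]=⇒lookup j∈)
... | yes pj | _ = pj
... | no _   | ()

weakenWalk : ∀ {n} {G : Graph n} {P Q : Fin n → Set} → (∀ x → P x → Q x) →
             ∀ {a b} → WalkIn G P a b → WalkIn G Q a b
weakenWalk P⇒Q (here pa) = here (P⇒Q _ pa)
weakenWalk P⇒Q (step pa a~w w⇝b) = step (P⇒Q _ pa) a~w (weakenWalk P⇒Q w⇝b)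

extendWalk : ∀ {n} {G : Graph n} {P : Fin n → Set} {a b c} →
             WalkIn G P a b → Adj G b c → P c → WalkIn G P a c
extendWalk (here pa) b~c pc = step pa b~c (here pc)
extendWalk (step pa a~w w⇝b) b~c pc = step pa a~w (extendWalk w⇝b b~c pc)

largeEnough-mono : ∀ n k p q {s t} → s ≤ t → LargeEnough n k p q s → LargeEnough n k p q t
largeEnough-mono _ k _ q s≤t large = ≤-trans large (*-monoʳ-≤ (q * k) (s≤s s≤t))

-- Shrinking the leader set keeps a family linked: vertices outside L are
-- outside L', so the old walks are still admissible.
restrictLeaders : ∀ {n} {G : Graph n} {k p q} {L L' : Subset n} {S : Fin n → Subset n} →
                  L' ⊆ L → LinkedFamily G k p q L S → LinkedFamily G k p q L' S
restrictLeaders {L = L} {L' = L'} L'⊆L (avoidsL , large , linked , disjoint) =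
    (λ i i∈L' j j∈S j∈L' → avoidsL i (L'⊆L i∈L') j j∈S (L'⊆L j∈L'))
  , (λ i i∈L' → large i (L'⊆L i∈L'))
  , (λ i i∈L' j j∈S → weakenWalk widen (linked i (L'⊆L i∈L') j j∈S))
  , (λ i i' i∈L' i'∈L' → disjoint i i' (L'⊆L i∈L') (L'⊆L i'∈L'))
  where
  widen : ∀ {i} x → InSOr L i x → InSOr L' i x
  widen x = [ (λ x∉L → inj₁ (λ x∈L' → x∉L (L'⊆L x∈L'))) , inj₂ ]′

module Completion {n} (G : Graph n) (connected : Connected G) (k p q : ℕ)
  (L : Subset n) (S : Fin n → Subset n) (family : LinkedFamily G k p q L S)
  (l₀ : Fin n) (l₀∈L : l₀ ∈ L) where

  avoidsL = proj₁ family
  large = proj₁ (proj₂ family)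
  linked = proj₁ (proj₂ (proj₂ family))
  disjoint = proj₂ (proj₂ (proj₂ family))

  Linked : Fin n → Set
  Linked u = Σ (Fin n) λ i → i ∈ L × WalkIn G (InSOr L i) i u

  claimed? : ∀ u → Dec (∃ λ i → i ∈ L × u ∈ S i)
  claimed? u = any? (λ i → (i ∈? L) ×-dec (u ∈? S i))

  claim : ∀ {u} → WalkIn G everywhere u l₀ → Linked u
  claim (here _) = l₀ , l₀∈L , here (inj₂ refl)
  claim {u} (step _ u~w w⇝l₀) with u ∈? L
  ... | yes u∈L = u , u∈L , here (inj₂ refl)
  ... | no u∉L with claimed? u
  ...   | yes (i , i∈L , u∈S) = i , i∈L , linked i i∈L u u∈S
  ...   | no _ with claim w⇝l₀
  ...     | i , i∈L , i⇝w = i , i∈L , extendWalk i⇝w (Graph.sym G u~w) (inj₁ u∉L)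

  claim-respects-S : ∀ {u} (u⇝l₀ : WalkIn G everywhere u l₀) i → i ∈ L → u ∈ S i →
                     proj₁ (claim u⇝l₀) ≡ i
  claim-respects-S (here _) i i∈L l₀∈S = ⊥-elim (avoidsL i i∈L l₀ l₀∈S l₀∈L)
  claim-respects-S {u} (step _ _ _) i i∈L u∈S with u ∈? L
  ... | yes u∈L = ⊥-elim (avoidsL i i∈L u u∈S u∈L)
  ... | no _ with claimed? u
  ...   | no unclaimed = ⊥-elim (unclaimed (i , i∈L , u∈S))
  ...   | yes (i' , i'∈L , u∈S') with i' ≟ᶠ i
  ...     | yes i'≡i = i'≡i
  ...     | no i'≢i = ⊥-elim (disjoint i' i i'∈L i∈L i'≢i u u∈S' u∈S)

  leaderOf : Fin n → Fin n
  leaderOf u = proj₁ (claim (connected u l₀))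

  Assigned : Fin n → Fin n → Set
  Assigned i j = j ∉ L × leaderOf j ≡ i

  S' : Fin n → Subset n
  S' i = comprehension (λ j → ¬? (j ∈? L) ×-dec (leaderOf j ≟ᶠ i))

  ∈S'⁺ : ∀ {i j} → Assigned i j → j ∈ S' i
  ∈S'⁺ {i} = ∈-comprehension⁺ (λ j → ¬? (j ∈? L) ×-dec (leaderOf j ≟ᶠ i))

  ∈S'⁻ : ∀ {i j} → j ∈ S' i → Assigned i j
  ∈S'⁻ {i} = ∈-comprehension⁻ (λ j → ¬? (j ∈? L) ×-dec (leaderOf j ≟ᶠ i))

  S⊆S' : ∀ i → i ∈ L → S i ⊆ S' i
  S⊆S' i i∈L {j} j∈S =
    ∈S'⁺ (avoidsL i i∈L j j∈S , claim-respects-S (connected j l₀) i i∈L j∈S)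

  completedFamily : LinkedFamily G k p q L S'
  completedFamily =
      (λ i _ j j∈S' → proj₁ (∈S'⁻ j∈S'))
    , (λ i i∈L → largeEnough-mono n k p q (p⊆q⇒∣p∣≤∣q∣ (S⊆S' i i∈L)) (large i i∈L))
    , (λ i _ j j∈S' → subst (λ l → WalkIn G (InSOr L l) l j) (proj₂ (∈S'⁻ j∈S'))
                            (proj₂ (proj₂ (claim (connected j l₀)))))
    , (λ i i' _ _ i≢i' j j∈S' j∈S'' →
         i≢i' (trans (≡-sym (proj₂ (∈S'⁻ j∈S'))) (proj₂ (∈S'⁻ j∈S''))))

  covers : ∀ j → j ∉ L → ∃[ i ] (i ∈ L × j ∈ S' i)
  covers j j∉L = leaderOf j , proj₁ (proj₂ (claim (connected j l₀))) , ∈S'⁺ (j∉L , refl)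

mainTheorem8 : (n : ℕ) (G : Graph n) → Connected G → (k p q : ℕ) → 1 ≤ k → 0 < p → p ≤ q → LinkedSubpartition G k p q → LinkedPartition G k p q
mainTheorem8 n G connected (suc k') p q _ _ _ (L , S , k≤∣L∣ , family)
  with exactSubset (suc k') L k≤∣L∣
... | L' , L'⊆L , ∣L'∣≡k with nonempty-of-size L' ∣L'∣≡k
... | l₀ , l₀∈L' =
  L' , S' , ∣L'∣≡k , completedFamily , covers
  where
  open Completion G connected (suc k') p q L' S (restrictLeaders {k = suc k'} {p} {q} L'⊆L family) l₀ l₀∈L'
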